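{- If $G$ is a transitive permutation group on a set $\Omega$ of cardinality $n$ and $g\in G$, then $$\mu(g) \le \left( \frac{n}{\ell(g)} -1\right) {\rm meo}_\circ(G) + 1 \quad \text{ and } \quad \mu(G) \le \left( \frac{n}{\ell(G)} -1\right) {\rm meo}_\circ(G) + 1.$$
   Context: For a permutation $g$: $o(g)$ is its order, $\ell(g)$ the length of a longest orbit of $\langle g\rangle$, $\mu(g)$ the number of orbits of $\langle g\rangle$. For a permutation group $G$: $\ell(G)=\max_{g\in G}\ell(g)$, $\mu(G)=\min_{g\in G}\mu(g)$, ${\rm meo}(H)=\max_{h\in H}o(h)$, and ${\rm meo}_\circ(G)=\max_{\omega\in\Omega}{\rm meo}(G_\omega)$, where $G_\omega$ is the stabiliser of $\omega$. -}

module Defs where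

open import Level using (0ℓ)
open import Data.Nat using (ℕ; zero; suc; _<_; _≤_)
open import Data.Integer using (ℤ; +_; -[1+_])
open import Data.Fin using (Fin)
open import Data.Fin.Permutation using (Permutation′; _⟨$⟩ʳ_; _∘ₚ_; flip; id; _≈_)
open import Data.Product using (Σ; ∃; _×_)
open import Relation.Binary.PropositionalEquality using (_≡_; _≢_)
open import Relation.Nullary using (¬_)

pow : ∀ {n} → Permutation′ n → ℕ → Fin n → Fin n
pow g zero    i = i
pow g (suc k) i = g ⟨$⟩ʳ pow g k i

zpow : ∀ {n} → Permutation′ n → ℤ → Fin n → Fin n
zpow g (+ k)      i = pow g k i
zpow g -[1+ k ]   i = pow (flip g) (suc k) i

IsOrder : ∀ {n} → Permutation′ n → ℕ → Set
IsOrder g k = (0 < k) × (∀ i → pow g k i ≡ i)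
            × (∀ j → 0 < j → j < k → ¬ (∀ i → pow g j i ≡ i))

SameOrbit : ∀ {n} → Permutation′ n → Fin n → Fin n → Set
SameOrbit g α β = ∃ λ (z : ℤ) → zpow g z α ≡ β

OrbitCard : ∀ {n} → Permutation′ n → Fin n → ℕ → Set
OrbitCard {n} g ω k = Σ (Fin k → Fin n) λ f →
    (∀ a b → f a ≡ f b → a ≡ b)
  × (∀ a → SameOrbit g ω (f a))
  × (∀ β → SameOrbit g ω β → ∃ λ a → f a ≡ β)

IsEll : ∀ {n} → Permutation′ n → ℕ → Set
IsEll {n} g L = (∃ λ (ω : Fin n) → OrbitCard g ω L)
              × (∀ ω k → OrbitCard g ω k → k ≤ L)

IsMu : ∀ {n} → Permutation′ n → ℕ → Set
IsMu {n} g m = Σ (Fin m → Fin n) λ r →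
    (∀ a b → SameOrbit g (r a) (r b) → a ≡ b)
  × (∀ β → ∃ λ a → SameOrbit g (r a) β)

record PermGroup (n : ℕ) : Set₁ where
  field
    _∈G      : Permutation′ n → Set
    resp     : ∀ {g h} → g ≈ h → g ∈G → h ∈G
    id-mem   : id ∈G
    comp-mem : ∀ {g h} → g ∈G → h ∈G → (g ∘ₚ h) ∈G
    inv-mem  : ∀ {g} → g ∈G → flip g ∈G
open PermGroup public

Transitive : ∀ {n} → PermGroup n → Set
Transitive {n} G = ∀ (α β : Fin n) → ∃ λ g → _∈G G g × (g ⟨$⟩ʳ α ≡ β)

IsEllG : ∀ {n} → PermGroup n → ℕ → Set
IsEllG G L = (∃ λ g → _∈G G g × IsEll g L)
           × (∀ g → _∈G G g → ∀ k → IsEll g k → k ≤ L)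

IsMuG : ∀ {n} → PermGroup n → ℕ → Set
IsMuG G m = (∃ λ g → _∈G G g × IsMu g m)
          × (∀ g → _∈G G g → ∀ k → IsMu g k → m ≤ k)

IsMeoCirc : ∀ {n} → PermGroup n → ℕ → Set
IsMeoCirc {n} G M =
    (∃ λ (ω : Fin n) → ∃ λ h → _∈G G h × (h ⟨$⟩ʳ ω ≡ ω) × IsOrder h M)
  × (∀ (ω : Fin n) h → _∈G G h → h ⟨$⟩ʳ ω ≡ ω → ∀ k → IsOrder h k → k ≤ M)

-- Let ω lie on a longest ⟨g⟩-orbit, of length ℓ = ℓ(g), and let x lie on any other orbit, of
-- length t.  Then g^t ∈ G_x has some order k ≤ meo∘(G), and g^(kt) fixes ω, so ℓ ≤ kt ≤ meo∘(G)·t.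
-- Hence each of the μ(g) − 1 orbits other than that of ω has at least ℓ/meo∘(G) points, giving
-- (μ(g) − 1)·ℓ ≤ (n − ℓ)·meo∘(G).  For μ(G), choose g with
-- ℓ(g) = ℓ(G) and use μ(G) ≤ μ(g).
module Submission where

open import Defs
open import Data.Nat using (ℕ; _*_; _+_; _∸_; _≤_)
open import Data.Fin.Permutation using (Permutation′)
open import Data.Product using (_×_)

open import Data.Nat using (zero; suc; _<_; s≤s⁻¹; z<s; NonZero; >-nonZero; _!)
open import Data.Nat.Properties
open import Data.Nat.DivMod using (_%_; _/_; m≡m%n+[m/n]*n; m%n<n; m<n*o⇒m/o<n)
open import Data.Nat.Divisibility using (_∣_; divides; ∣-trans; m∣m*n; m≤n⇒m!∣n!)
open import Data.Fin as Fin using (Fin; toℕ; fromℕ<; punchIn)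
import Data.Fin.Properties as Finₚ
open import Data.Fin.Permutation using (_⟨$⟩ʳ_; flip; id; _∘ₚ_; inverseʳ)
open import Data.Integer using (+_; -[1+_])
open import Data.Product using (∃; _,_; proj₁; proj₂)
open import Data.Sum using (_⊎_; inj₁; inj₂)
open import Data.Sum.Function.Propositional using (_⊎-↔_)
open import Data.List using (List; _∷_; length; lookup; filter; allFin)
open import Data.List.Relation.Unary.AllPairs using (_∷_)
open import Data.List.Relation.Unary.Unique.Propositional using (Unique)
import Data.List.Relation.Unary.Unique.Propositional.Properties as Uniqueₚ
import Data.List.Relation.Unary.All as All
import Data.List.Relation.Unary.Any as Any
open import Data.List.Relation.Unary.Any.Properties using (lookup-index)
open import Data.List.Membership.Propositional.Properties using (∈-lookup; ∈-filter⁺; ∈-filter⁻; ∈-allFin)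
open import Data.Empty using (⊥-elim)
open import Function.Bundles using (Injection; _↣_; mk↣)
open import Function.Definitions using (Injective)
open import Function.Properties.Inverse using (↔-trans; ↔-sym; ↔⇒↣)
open import Function.Properties.Injection using (↣-trans)
open import Relation.Binary.PropositionalEquality
open import Relation.Binary.Definitions using (tri<; tri≈; tri>)
open import Relation.Nullary using (Dec; yes; no; ¬_)
open import Relation.Nullary.Decidable using (_×-dec_; map′; ¬?)
open import Relation.Unary using (Decidable)

LeastPositive : (ℕ → Set) → ℕ → Set
LeastPositive Q k = 0 < k × Q k × (∀ j → 0 < j → j < k → ¬ Q j)

module _ {Q : ℕ → Set} (Q? : Decidable Q) where

  private
    search : ∀ k d → 0 < k → (∀ j → 0 < j → j < k → ¬ Q j) → Q (d + k) → ∃ (LeastPositive Q)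
    search k d k>0 below q with Q? k
    ... | yes qk = k , k>0 , qk , below
    search k zero    k>0 below q | no ¬qk = ⊥-elim (¬qk q)
    search k (suc d) k>0 below q | no ¬qk =
      search (suc k) d z<s below′ (subst Q (sym (+-suc d k)) q)
      where
      below′ : ∀ j → 0 < j → j < suc k → ¬ Q j
      below′ j j>0 j<1+k with m<1+n⇒m<n∨m≡n j<1+k
      ... | inj₁ j<k  = below j j>0 j<k
      ... | inj₂ refl = ¬qk

  leastPositive : ∀ {p} → 0 < p → Q p → ∃ (LeastPositive Q)
  leastPositive {suc p} _ q =
    search 1 p z<s (λ j j>0 j<1 → ⊥-elim (<⇒≱ j<1 j>0)) (subst Q (sym (+-comm p 1)) q)

%-/-injective : ∀ {i j d} .{{_ : NonZero d}} → i % d ≡ j % d → i / d ≡ j / d → i ≡ j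
%-/-injective {i} {j} {d} same-rem same-quot = begin
  i                 ≡⟨ m≡m%n+[m/n]*n i d ⟩
  i % d + i / d * d ≡⟨ cong₂ (λ r q → r + q * d) same-rem same-quot ⟩
  j % d + j / d * d ≡⟨ m≡m%n+[m/n]*n j d ⟨
  j                 ∎
  where open ≡-Reasoning

m*l+l*k≤n*k⇒l*[1+m]≤[n∸l]*k+l : ∀ {m l k n} → m * l + l * k ≤ n * k → l * suc m ≤ (n ∸ l) * k + l
m*l+l*k≤n*k⇒l*[1+m]≤[n∸l]*k+l {m} {l} {k} {n} le = begin
  l * suc m         ≡⟨ trans (*-comm l (suc m)) (+-comm l (m * l)) ⟩
  m * l + l         ≤⟨ +-monoˡ-≤ l (m+n≤o⇒m≤o∸n (m * l) le) ⟩
  n * k ∸ l * k + l ≡⟨ cong (_+ l) (*-distribʳ-∸ k n l) ⟨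
  (n ∸ l) * k + l   ∎
  where open ≤-Reasoning

↣⇒≤ : ∀ {a b} → Fin a ↣ Fin b → a ≤ b
↣⇒≤ a↣b = Finₚ.injective⇒≤ (Injection.injective a↣b)

k∣n! : ∀ {k n} → 0 < k → k ≤ n → k ∣ n !
k∣n! {suc k} _ k≤n = ∣-trans (m∣m*n (k !)) (m≤n⇒m!∣n! k≤n)

lookup-injective : ∀ {A : Set} {xs : List A} → Unique xs → ∀ i j → lookup xs i ≡ lookup xs j → i ≡ j
lookup-injective {xs = _ ∷ _} (_ ∷ _)  Fin.zero    Fin.zero    _  = refl
lookup-injective {xs = _ ∷ _} (x∉ ∷ _) Fin.zero    (Fin.suc j) eq = ⊥-elim (All.lookup x∉ (∈-lookup j) eq)
lookup-injective {xs = _ ∷ _} (x∉ ∷ _) (Fin.suc i) Fin.zero    eq = ⊥-elim (All.lookup x∉ (∈-lookup i) (sym eq))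
lookup-injective {xs = _ ∷ _} (_ ∷ u)  (Fin.suc i) (Fin.suc j) eq = cong Fin.suc (lookup-injective u i j eq)

module _ {n : ℕ} (g : Permutation′ n) where

  open ≡-Reasoning

  pow-+ : ∀ a b x → pow g (a + b) x ≡ pow g a (pow g b x)
  pow-+ zero    b x = refl
  pow-+ (suc a) b x = cong (g ⟨$⟩ʳ_) (pow-+ a b x)

  pow-injective : ∀ k {x y} → pow g k x ≡ pow g k y → x ≡ y
  pow-injective zero    eq = eq
  pow-injective (suc k) eq = pow-injective k (Injection.injective (↔⇒↣ g) eq)

  pow-*-fixed : ∀ {p x} → pow g p x ≡ x → ∀ q → pow g (q * p) x ≡ x
  pow-*-fixed e zero = refl
  pow-*-fixed {p} {x} e (suc q) = begin
    pow g (p + q * p) x       ≡⟨ pow-+ p (q * p) x ⟩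
    pow g p (pow g (q * p) x) ≡⟨ cong (pow g p) (pow-*-fixed e q) ⟩
    pow g p x                 ≡⟨ e ⟩
    x                         ∎

  pow-% : ∀ {p x} .{{_ : NonZero p}} → pow g p x ≡ x → ∀ k → pow g k x ≡ pow g (k % p) x
  pow-% {p} {x} e k = begin
    pow g k x                           ≡⟨ cong (λ i → pow g i x) (m≡m%n+[m/n]*n k p) ⟩
    pow g (k % p + k / p * p) x         ≡⟨ pow-+ (k % p) (k / p * p) x ⟩
    pow g (k % p) (pow g (k / p * p) x) ≡⟨ cong (pow g (k % p)) (pow-*-fixed e (k / p)) ⟩
    pow g (k % p) x                     ∎

  pow-∸ : ∀ {a b x} → a ≤ b → pow g a x ≡ pow g b x → pow g (b ∸ a) x ≡ x
  pow-∸ {a} {b} {x} a≤b eq = pow-injective a (begin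
    pow g a (pow g (b ∸ a) x) ≡⟨ pow-+ a (b ∸ a) x ⟨
    pow g (a + (b ∸ a)) x     ≡⟨ cong (λ i → pow g i x) (m+[n∸m]≡n a≤b) ⟩
    pow g b x                 ≡⟨ eq ⟨
    pow g a x                 ∎)

  pow-flip : ∀ k y → pow g k (pow (flip g) k y) ≡ y
  pow-flip zero    y = refl
  pow-flip (suc k) y = begin
    pow g (suc k) (flip g ⟨$⟩ʳ z)    ≡⟨ cong (λ i → pow g i (flip g ⟨$⟩ʳ z)) (+-comm 1 k) ⟩
    pow g (k + 1) (flip g ⟨$⟩ʳ z)    ≡⟨ pow-+ k 1 (flip g ⟨$⟩ʳ z) ⟩
    pow g k (g ⟨$⟩ʳ (flip g ⟨$⟩ʳ z)) ≡⟨ cong (pow g k) (inverseʳ g) ⟩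
    pow g k z                        ≡⟨ pow-flip k y ⟩
    y                                ∎
    where z = pow (flip g) k y

  period≤n : ∀ x → ∃ λ p → 0 < p × p ≤ n × pow g p x ≡ x
  period≤n x with Finₚ.pigeonhole (n<1+n n) (λ (i : Fin (suc n)) → pow g (toℕ i) x)
  ... | i , j , i<j , eq =
    toℕ j ∸ toℕ i , m<n⇒0<n∸m i<j , ≤-trans (m∸n≤m (toℕ j) (toℕ i)) (Finₚ.toℕ≤pred[n] j) ,
    pow-∸ (<⇒≤ i<j) eq

  MinimalPeriod : Fin n → ℕ → Set
  MinimalPeriod x = LeastPositive (λ k → pow g k x ≡ x)

  minimalPeriod : ∀ x → ∃ (MinimalPeriod x)
  minimalPeriod x with period≤n x
  ... | _ , p>0 , _ , fixed = leastPositive (λ k → pow g k x Finₚ.≟ x) p>0 fixed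

  pow-≢-<period : ∀ {x T i j} → MinimalPeriod x T → i < j → j < T → pow g i x ≢ pow g j x
  pow-≢-<period {i = i} {j} (_ , _ , minimal) i<j j<T eq =
    minimal (j ∸ i) (m<n⇒0<n∸m i<j) (≤-<-trans (m∸n≤m j i) j<T) (pow-∸ (<⇒≤ i<j) eq)

  pow-injective-<period : ∀ {x T i j} → MinimalPeriod x T → i < T → j < T →
                          pow g i x ≡ pow g j x → i ≡ j
  pow-injective-<period {i = i} {j} period i<T j<T eq with <-cmp i j
  ... | tri< i<j _ _ = ⊥-elim (pow-≢-<period period i<j j<T eq)
  ... | tri≈ _ i≡j _ = i≡j
  ... | tri> _ _ j<i = ⊥-elim (pow-≢-<period period j<i i<T (sym eq))

  Reaches : Fin n → Fin n → Set
  Reaches α β = ∃ λ k → pow g k α ≡ β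

  reaches-refl : ∀ {α} → Reaches α α
  reaches-refl = 0 , refl

  reaches-trans : ∀ {α β γ} → Reaches α β → Reaches β γ → Reaches α γ
  reaches-trans {α} (a , α→β) (b , β→γ) = b + a , trans (pow-+ b a α) (trans (cong (pow g b) α→β) β→γ)

  reaches-sym : ∀ {α β} → Reaches α β → Reaches β α
  reaches-sym {α} {β} (k , α→β) with period≤n α
  ... | suc p , _ , _ , α-fixed = p * k , (begin
    pow g (p * k) β           ≡⟨ cong (pow g (p * k)) α→β ⟨
    pow g (p * k) (pow g k α) ≡⟨ pow-+ (p * k) k α ⟨
    pow g (p * k + k) α       ≡⟨ cong (λ i → pow g i α) (trans (+-comm (p * k) k) (*-comm (suc p) k)) ⟩
    pow g (k * suc p) α       ≡⟨ pow-*-fixed α-fixed k ⟩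
    α                         ∎)

  reaches⇒sameOrbit : ∀ {α β} → Reaches α β → SameOrbit g α β
  reaches⇒sameOrbit (k , α→β) = + k , α→β

  sameOrbit⇒reaches : ∀ {α β} → SameOrbit g α β → Reaches α β
  sameOrbit⇒reaches (+ k , α→β) = k , α→β
  sameOrbit⇒reaches {α} (-[1+ k ] , α→β) =
    reaches-sym (suc k , trans (cong (pow g (suc k)) (sym α→β)) (pow-flip (suc k) α))

  reaches-bounded : ∀ {α β} → Reaches α β → ∃ λ (k : Fin (suc n)) → pow g (toℕ k) α ≡ β
  reaches-bounded {α} (k , α→β) with period≤n α
  ... | suc p , _ , p≤n , α-fixed =
    fromℕ< k%p<1+n , trans (cong (λ i → pow g i α) (Finₚ.toℕ-fromℕ< k%p<1+n)) (trans (sym (pow-% α-fixed k)) α→β)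
    where
    k%p<1+n : k % suc p < suc n
    k%p<1+n = <-≤-trans (m%n<n k (suc p)) (m≤n⇒m≤1+n p≤n)

  reaches? : ∀ α β → Dec (Reaches α β)
  reaches? α β = map′ (λ (k , α→β) → toℕ k , α→β) reaches-bounded
                      (Finₚ.any? (λ k → pow g (toℕ k) α Finₚ.≟ β))

  orbitCard≤period : ∀ {ω L k} → OrbitCard g ω L → 0 < k → pow g k ω ≡ ω → L ≤ k
  orbitCard≤period {ω} {L} {k} (f , f-injective , f-in-orbit , _) k>0 ω-fixed =
    Finₚ.injective⇒≤ exponent-injective
    where
    instance
      k≢0 : NonZero k
      k≢0 = >-nonZero k>0
    exponentOf : Fin L → ℕ
    exponentOf c = proj₁ (sameOrbit⇒reaches (f-in-orbit c)) % k
    f≡pow : ∀ c → f c ≡ pow g (exponentOf c) ω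
    f≡pow c with sameOrbit⇒reaches (f-in-orbit c)
    ... | i , ω→fc = trans (sym ω→fc) (pow-% ω-fixed i)
    exponent : Fin L → Fin k
    exponent c = fromℕ< (m%n<n _ k)
    exponent-injective : Injective _≡_ _≡_ exponent
    exponent-injective {c} {c′} eq = f-injective c c′ (begin
      f c                     ≡⟨ f≡pow c ⟩
      pow g (exponentOf c) ω  ≡⟨ cong (λ i → pow g i ω) (Finₚ.fromℕ<-injective _ _ _ _ eq) ⟩
      pow g (exponentOf c′) ω ≡⟨ f≡pow c′ ⟨
      f c′                    ∎)

  OrbitLeast : Fin n → Set
  OrbitLeast i = ∀ j → j Fin.< i → ¬ Reaches j i

  private
    smallerInOrbit? : ∀ i → Dec (∃ λ j → j Fin.< i × Reaches j i)
    smallerInOrbit? i = Finₚ.any? λ j → j Finₚ.<? i ×-dec reaches? j i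

  orbitLeast? : Decidable OrbitLeast
  orbitLeast? i = map′ (λ ¬smaller j j<i j→i → ¬smaller (j , j<i , j→i))
                       (λ least (j , j<i , j→i) → least j j<i j→i)
                       (¬? (smallerInOrbit? i))

  orbitLeast-reaches : ∀ β → ∃ λ i → OrbitLeast i × Reaches i β
  orbitLeast-reaches β = descend (suc (toℕ β)) β ≤-refl reaches-refl
    where
    descend : ∀ k i → toℕ i < k → Reaches i β → ∃ λ i → OrbitLeast i × Reaches i β
    descend (suc k) i i<1+k i→β with smallerInOrbit? i
    ... | yes (j , j<i , j→i) = descend k j (<-≤-trans j<i (s≤s⁻¹ i<1+k)) (reaches-trans j→i i→β)
    ... | no ¬smaller         = i , (λ j j<i j→i → ¬smaller (j , j<i , j→i)) , i→β

  orbitLeasts : List (Fin n)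
  orbitLeasts = filter orbitLeast? (allFin n)

  orbitLeasts-isMu : IsMu g (length orbitLeasts)
  orbitLeasts-isMu = lookup orbitLeasts , distinct-orbits , covering
    where
    isOrbitLeast : ∀ a → OrbitLeast (lookup orbitLeasts a)
    isOrbitLeast a = proj₂ (∈-filter⁻ orbitLeast? {xs = allFin n} (∈-lookup a))
    distinct-orbits : ∀ a b → SameOrbit g (lookup orbitLeasts a) (lookup orbitLeasts b) → a ≡ b
    distinct-orbits a b a~b = lookup-injective (Uniqueₚ.filter⁺ orbitLeast? (Uniqueₚ.allFin⁺ n)) a b same
      where
      same : lookup orbitLeasts a ≡ lookup orbitLeasts b
      same with Finₚ.<-cmp (lookup orbitLeasts a) (lookup orbitLeasts b)
      ... | tri< a<b _ _ = ⊥-elim (isOrbitLeast b _ a<b (sameOrbit⇒reaches a~b))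
      ... | tri≈ _ a≡b _ = a≡b
      ... | tri> _ _ b<a = ⊥-elim (isOrbitLeast a _ b<a (reaches-sym (sameOrbit⇒reaches a~b)))
    covering : ∀ β → ∃ λ a → SameOrbit g (lookup orbitLeasts a) β
    covering β with orbitLeast-reaches β
    ... | i , least , i→β = Any.index i∈ , reaches⇒sameOrbit (subst (λ j → Reaches j β) (lookup-index i∈) i→β)
      where i∈ = ∈-filter⁺ orbitLeast? (∈-allFin i) least

-- Since L ≤ M·T, the points of Fin L fit into M copies of the orbit of x, of length T.
module OrbitCoding {n} (g : Permutation′ n) {x T} (period : MinimalPeriod g x T) {L M} (L≤M*T : L ≤ M * T) where

  private
    instance
      T≢0 : NonZero T
      T≢0 = >-nonZero (proj₁ period)

  quotient<M : (j : Fin L) → toℕ j / T < M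
  quotient<M j = m<n*o⇒m/o<n (<-≤-trans (Finₚ.toℕ<n j) L≤M*T)

  code : Fin L → Fin n × Fin M
  code j = pow g (toℕ j % T) x , fromℕ< (quotient<M j)

  code-reaches : ∀ j → Reaches g x (proj₁ (code j))
  code-reaches j = toℕ j % T , refl

  code-injective : Injective _≡_ _≡_ code
  code-injective {i} {j} eq = Finₚ.toℕ-injective (%-/-injective same-rem same-quot)
    where
    same-rem : toℕ i % T ≡ toℕ j % T
    same-rem = pow-injective-<period g period (m%n<n (toℕ i) T) (m%n<n (toℕ j) T) (cong proj₁ eq)
    same-quot : toℕ i / T ≡ toℕ j / T
    same-quot = Finₚ.fromℕ<-injective _ _ (quotient<M i) (quotient<M j) (cong proj₂ eq)

mu-bound : ∀ {n} (g : Permutation′ n) {ω L m M} → OrbitCard g ω L → IsMu g m →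
           (∀ {x T} → MinimalPeriod g x T → L ≤ M * T) → L * m ≤ (n ∸ L) * M + L
mu-bound g {ω} _ (_ , _ , covering) _ with covering ω
mu-bound g {m = zero} _ _ _ | () , _
mu-bound {n} g {ω} {L} {suc m} {M} (f , f-injective , f-in-orbit , _) (r , distinct-orbits , _) orbit≥
  | a₀ , r₀~ω = m*l+l*k≤n*k⇒l*[1+m]≤[n∸l]*k+l {m} {L} {M} {n} (↣⇒≤ embedding)
  where
  other : Fin m → Fin n
  other b = r (punchIn a₀ b)

  module Code (b : Fin m) =
    OrbitCoding g (proj₂ (minimalPeriod g (other b))) {M = M} (orbit≥ (proj₂ (minimalPeriod g (other b))))

  same-other : ∀ {b b′ y} → Reaches g (other b) y → Reaches g (other b′) y → b ≡ b′
  same-other b→y b′→y = Finₚ.punchIn-injective a₀ _ _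
    (distinct-orbits _ _ (reaches⇒sameOrbit g (reaches-trans g b→y (reaches-sym g b′→y))))

  other∉orbit[ω] : ∀ {b y} → Reaches g (other b) y → ¬ SameOrbit g ω y
  other∉orbit[ω] {b} b→y ω~y = Finₚ.punchInᵢ≢i a₀ b (sym (distinct-orbits _ _ (reaches⇒sameOrbit g
    (reaches-trans g (sameOrbit⇒reaches g r₀~ω) (reaches-trans g (sameOrbit⇒reaches g ω~y) (reaches-sym g b→y))))))

  Φ : (Fin m × Fin L) ⊎ (Fin L × Fin M) → Fin n × Fin M
  Φ (inj₁ (b , j)) = Code.code b j
  Φ (inj₂ (c , d)) = f c , d

  Φ-injective : Injective _≡_ _≡_ Φ
  Φ-injective {inj₁ (b , j)} {inj₁ (b′ , j′)} eq
    with same-other (Code.code-reaches b j) (subst (Reaches g (other b′)) (sym (cong proj₁ eq)) (Code.code-reaches b′ j′))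
  ... | refl = cong (λ j → inj₁ (b , j)) (Code.code-injective b eq)
  Φ-injective {inj₁ (b , j)} {inj₂ (c , _)} eq =
    ⊥-elim (other∉orbit[ω] (Code.code-reaches b j) (subst (SameOrbit g ω) (sym (cong proj₁ eq)) (f-in-orbit c)))
  Φ-injective {inj₂ (c , _)} {inj₁ (b , j)} eq =
    ⊥-elim (other∉orbit[ω] (Code.code-reaches b j) (subst (SameOrbit g ω) (cong proj₁ eq) (f-in-orbit c)))
  Φ-injective {inj₂ (c , d)} {inj₂ (c′ , d′)} eq =
    cong₂ (λ c d → inj₂ (c , d)) (f-injective c c′ (cong proj₁ eq)) (cong proj₂ eq)

  embedding : Fin (m * L + L * M) ↣ Fin (n * M)
  embedding = ↣-trans (↔⇒↣ (↔-trans Finₚ.+↔⊎ (Finₚ.*↔× ⊎-↔ Finₚ.*↔×)))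
                      (↣-trans (mk↣ Φ-injective) (↔⇒↣ (↔-sym Finₚ.*↔×)))

_^ₚ_ : ∀ {n} → Permutation′ n → ℕ → Permutation′ n
g ^ₚ zero  = id
g ^ₚ suc k = (g ^ₚ k) ∘ₚ g

^ₚ-⟨$⟩ʳ : ∀ {n} (g : Permutation′ n) k x → (g ^ₚ k) ⟨$⟩ʳ x ≡ pow g k x
^ₚ-⟨$⟩ʳ g zero    x = refl
^ₚ-⟨$⟩ʳ g (suc k) x = cong (g ⟨$⟩ʳ_) (^ₚ-⟨$⟩ʳ g k x)

pow-^ₚ : ∀ {n} (g : Permutation′ n) t j x → pow (g ^ₚ t) j x ≡ pow g (j * t) x
pow-^ₚ g t zero    x = refl
pow-^ₚ g t (suc j) x = begin
  (g ^ₚ t) ⟨$⟩ʳ pow (g ^ₚ t) j x ≡⟨ ^ₚ-⟨$⟩ʳ g t _ ⟩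
  pow g t (pow (g ^ₚ t) j x)     ≡⟨ cong (pow g t) (pow-^ₚ g t j x) ⟩
  pow g t (pow g (j * t) x)      ≡⟨ pow-+ g t (j * t) x ⟨
  pow g (t + j * t) x            ∎
  where open ≡-Reasoning

^ₚ-∈G : ∀ {n} (G : PermGroup n) {g} → _∈G G g → ∀ k → _∈G G (g ^ₚ k)
^ₚ-∈G G g∈G zero    = id-mem G
^ₚ-∈G G g∈G (suc k) = comp-mem G (^ₚ-∈G G g∈G k) g∈G

-- g^(n!) = 1, since every point returns after at most n steps
order : ∀ {n} (h : Permutation′ n) → ∃ (IsOrder h)
order {n} h = leastPositive (λ k → Finₚ.all? λ i → pow h k i Finₚ.≟ i) (1≤n! n) n!-fixes
  where
  n!-fixes : ∀ i → pow h (n !) i ≡ i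
  n!-fixes i with period≤n h i
  ... | p , p>0 , p≤n , i-fixed with k∣n! p>0 p≤n
  ...   | divides q n!≡q*p = trans (cong (λ k → pow h k i) n!≡q*p) (pow-*-fixed h i-fixed q)

orbitCard≤meo*period : ∀ {n} (G : PermGroup n) {M} → IsMeoCirc G M → ∀ {g} → _∈G G g →
                       ∀ {ω L} → OrbitCard g ω L → ∀ {x T} → 0 < T → pow g T x ≡ x → L ≤ M * T
orbitCard≤meo*period G {M} (_ , meo-maximal) {g} g∈G {ω} {L} orbit {x} {T} T>0 x-fixed with order (g ^ₚ T)
... | K , order[gᵀ]≡K@(K>0 , gᵀᴷ≡id , _) = begin
  L     ≤⟨ orbitCard≤period g orbit (*-mono-≤ K>0 T>0) (trans (sym (pow-^ₚ g T K ω)) (gᵀᴷ≡id ω)) ⟩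
  K * T ≤⟨ *-monoˡ-≤ T K≤M ⟩
  M * T ∎
  where
  open ≤-Reasoning
  K≤M : K ≤ M
  K≤M = meo-maximal x (g ^ₚ T) (^ₚ-∈G G g∈G T) (trans (^ₚ-⟨$⟩ʳ g T x) x-fixed) K order[gᵀ]≡K

lemma2p4 : (n : ℕ) (G : PermGroup n) → Transitive G →
    (M : ℕ) → IsMeoCirc G M →
      ((g : Permutation′ n) → _∈G G g → (L m : ℕ) → IsEll g L → IsMu g m →
         L * m ≤ (n ∸ L) * M + L)
    × ((L m : ℕ) → IsEllG G L → IsMuG G m →
         L * m ≤ (n ∸ L) * M + L)
lemma2p4 n G _ M meo = element-bound , group-bound
  where
  element-bound : (g : Permutation′ n) → _∈G G g → (L m : ℕ) → IsEll g L → IsMu g m →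
                  L * m ≤ (n ∸ L) * M + L
  element-bound g g∈G L m ((ω , orbit) , _) μ[g]≡m =
    mu-bound g orbit μ[g]≡m λ (T>0 , x-fixed , _) → orbitCard≤meo*period G meo g∈G orbit T>0 x-fixed

  group-bound : (L m : ℕ) → IsEllG G L → IsMuG G m → L * m ≤ (n ∸ L) * M + L
  group-bound L m ((g , g∈G , ℓ[g]≡L) , _) (_ , μ[G]≤) = begin
    L * m                      ≤⟨ *-monoʳ-≤ L (μ[G]≤ g g∈G _ (orbitLeasts-isMu g)) ⟩
    L * length (orbitLeasts g) ≤⟨ element-bound g g∈G L _ ℓ[g]≡L (orbitLeasts-isMu g) ⟩
    (n ∸ L) * M + L            ∎
    where open ≤-Reasoning
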